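{- Let $\pi$ be a permutation. Then there exists $m\in\mathbb{N}$ such that $s_{\{123,132\}}^{m}(\pi)$ (the $m$-fold iterate) is half-decreasing.
   Context: A permutation $\pi$ of length $n$ is half-decreasing if the subsequence $\pi(n-1)\pi(n-3)\cdots\pi(2)$ (for odd $n$), respectively $\pi(n-1)\pi(n-3)\cdots\pi(3)$ (for even $n$), is literally equal to $1\,2\cdots\lfloor\frac{n-1}{2}\rfloor$ (i.e. $\pi(n-1)=1$, $\pi(n-3)=2$, etc.). A sequence of distinct integers contains a permutation $\tau$ if some subsequence is order-isomorphic to $\tau$; otherwise it avoids $\tau$. For a set $T$ of permutations, the map $s_T$ is defined by: read the input permutation left to right with an initially empty stack and output; at each step, if there is a next input element and pushing it keeps the stack contents, read from top to bottom, $T$-avoiding, push it; otherwise pop the top of the stack and append it to the output; stop when input and stack are empty; the output is $s_T(\pi)$. -}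

module Defs where

open import Data.Nat using (ℕ; zero; suc; _+_; _*_; _∸_; _<_; _≤_)
open import Data.List using (List; []; _∷_; _++_; [_]; length)
open import Data.List.Relation.Binary.Sublist.Propositional using (_⊆_)
open import Data.List.Relation.Unary.All using (All)
open import Data.Product using (Σ; _×_; _,_; ∃)
open import Data.Maybe using (Maybe; just; nothing)
open import Data.Empty using (⊥)
open import Relation.Nullary using (¬_)
open import Function.Bundles using (_⇔_)

data PairsAgree (x y : ℕ) : List ℕ → List ℕ → Set where
  []  : PairsAgree x y [] []
  _∷_ : ∀ {a b as bs} → ((x < a) ⇔ (y < b)) × ((a < x) ⇔ (b < y)) →
        PairsAgree x y as bs → PairsAgree x y (a ∷ as) (b ∷ bs)

data OrderIso : List ℕ → List ℕ → Set where
  []  : OrderIso [] []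
  _∷_ : ∀ {x y xs ys} →
        PairsAgree x y xs ys → OrderIso xs ys → OrderIso (x ∷ xs) (y ∷ ys)

Contains : List ℕ → List ℕ → Set
Contains σ τ = ∃ λ sub → (sub ⊆ σ) × OrderIso sub τ

Avoids : List ℕ → List ℕ → Set
Avoids σ τ = ¬ Contains σ τ

AvoidsAll : List (List ℕ) → List ℕ → Set
AvoidsAll T σ = All (Avoids σ) T

-- Configurations of the stack machine: (remaining input, stack, output).
-- The stack is a list whose head is the top, so the list itself is the
-- stack contents read from top to bottom.
record Config : Set where
  constructor ⟨_,_,_⟩
  field
    input  : List ℕ
    stack  : List ℕ
    output : List ℕ

CanPush : List (List ℕ) → List ℕ → List ℕ → Set
CanPush T []      st = ⊥
CanPush T (x ∷ _) st = AvoidsAll T (x ∷ st)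

data Step (T : List (List ℕ)) : Config → Config → Set where
  push : ∀ {x inp st out} → AvoidsAll T (x ∷ st) →
         Step T ⟨ x ∷ inp , st , out ⟩ ⟨ inp , x ∷ st , out ⟩
  pop  : ∀ {inp y st out} → ¬ CanPush T inp (y ∷ st) →
         Step T ⟨ inp , y ∷ st , out ⟩ ⟨ inp , st , out ++ [ y ] ⟩

data Run (T : List (List ℕ)) : Config → Config → Set where
  done : ∀ {c} → Run T c c
  _▸_  : ∀ {c d e} → Step T c d → Run T d e → Run T c e

-- s_T(π) = σ : the machine started on input π with empty stack and output
-- reaches empty input and empty stack with output σ.  (The machine is
-- deterministic, so this relation is the graph of the map s_T.)
STSorts : List (List ℕ) → List ℕ → List ℕ → Set
STSorts T π σ = Run T ⟨ π , [] , [] ⟩ ⟨ [] , [] , σ ⟩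

data Iterate (T : List (List ℕ)) : ℕ → List ℕ → List ℕ → Set where
  zero : ∀ {π} → Iterate T zero π π
  suc  : ∀ {m π σ ρ} → STSorts T π σ → Iterate T m σ ρ → Iterate T (suc m) π ρ

_!_ : List ℕ → ℕ → Maybe ℕ
[]       ! _     = nothing
(x ∷ _)  ! zero  = just x
(_ ∷ xs) ! suc i = xs ! i

-- Half-decreasing: with n = length π and 1-indexed positions,
-- π(n+1-2k) = k for all 1 ≤ k ≤ ⌊(n-1)/2⌋, i.e. 2k+1 ≤ n.
-- In 0-indexed terms: π ! (n ∸ 2k) ≡ just k.
HalfDecreasing : List ℕ → Set
HalfDecreasing π = ∀ k → 1 ≤ k → 2 * k + 1 ≤ length π →
                   π ! (length π ∸ 2 * k) ≡ just k
  where open import Relation.Binary.PropositionalEquality using (_≡_)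

p123 p132 : List ℕ
p123 = 1 ∷ 2 ∷ 3 ∷ []
p132 = 1 ∷ 3 ∷ 2 ∷ []

T₁₂₃,₁₃₂ : List (List ℕ)
T₁₂₃,₁₃₂ = p123 ∷ p132 ∷ []

open import Data.List using (map; upTo)
open import Data.List.Relation.Binary.Permutation.Propositional using (_↭_)
IsPerm : ℕ → List ℕ → Set
IsPerm n π = π ↭ map suc (upTo n)

module Submission where

-- A stack read from top to bottom avoids 123 and 132 exactly when every entry
-- has at most one larger entry below it, so s_{123,132} pops until at most one
-- stack entry exceeds the next input x, and then pushes x.
--
-- Write zigzag (a₁ … a_k) = k a₁ (k−1) a₂ … 1 a_k and consider permutations
-- A ++ zigzag as in which A and as only contain values above k.  Every
-- permutation has this shape with k = 0, and it is half-decreasing as soon as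
-- |A| ≤ 2.  One pass preserves the shape: the head c of A stays at the bottom
-- of the stack, and each of k, k−1, … clears the stack down to c, so
-- (c ∷ A₀) ++ zigzag (a ∷ as) becomes (B ++ [a]) ++ zigzag (as ++ [c]) with
-- |B| = |A₀|.  Thus the value k+1 moves one step towards A with every pass
-- (from the head of A it jumps to the end of as) until it lies in A behind its
-- head a₀; then pushing it clears the stack down to a₀ as well, and the pass
-- yields B ++ zigzag (as ++ [a₀]) with |B| = |A| − 2.

open import Defs
open import Data.Nat using (ℕ; zero; suc; _+_; _*_; _∸_; _<_; _≤_; z≤n; s≤s; s≤s⁻¹; z<s; s<s; _<?_; _≤?_)
open import Data.Nat.Properties
open import Data.List using (List; []; _∷_; _++_; [_]; length; filter; map; upTo; applyDownFrom)
open import Data.List.Properties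
  using ( ++-assoc; length-++; length-++-comm; ++-identityʳ; filter-all; filter-reject; length-filter
        ; length-map; length-upTo)
open import Data.List.Membership.Propositional using (_∈_)
open import Data.List.Membership.Propositional.Properties
  using (∈-map⁻; ∈-map⁺; ∈-upTo⁺; ∈-++⁺ʳ; ∈-++⁻; ∈-∃++; ∈-applyDownFrom⁺; ∈-applyDownFrom⁻)
open import Data.List.Relation.Binary.Permutation.Propositional
  using (_↭_; prep; ↭-sym; ↭-trans; ↭-refl; ↭-reflexive; ↭⇒↭ₛ)
open import Data.List.Relation.Binary.Permutation.Propositional.Properties
  using (All-resp-↭; ∈-resp-↭; ↭-length; shift; shifts; ++⁺ˡ)
import Data.List.Relation.Binary.Permutation.Setoid.Properties as PermutationSetoid
open import Data.List.Relation.Binary.Sublist.Heterogeneous using ([]; _∷ʳ_; _∷_; minimum)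
open import Data.List.Relation.Binary.Sublist.Propositional using (_⊆_; ⊆-refl; ⊆-trans)
import Data.List.Relation.Binary.Sublist.Propositional.Properties as Sublist
open import Data.List.Relation.Unary.All using (All; []; _∷_)
import Data.List.Relation.Unary.All as All
import Data.List.Relation.Unary.All.Properties as All
open import Data.List.Relation.Unary.AllPairs using (_∷_)
open import Data.List.Relation.Unary.Any using (here; there)
open import Data.List.Relation.Unary.Unique.Propositional using (Unique)
import Data.List.Relation.Unary.Unique.Propositional.Properties as Unique
open import Data.Maybe using (just)
open import Data.Product using (_×_; _,_; ∃; proj₁; proj₂; map₁)
open import Data.Sum using (inj₁; inj₂)
open import Data.Empty using (⊥)
open import Function.Base using (_∘_)
open import Function.Bundles using (_⇔_; mk⇔; Equivalence)
open import Relation.Nullary using (¬_; Dec; yes; no; contradiction)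
open import Relation.Binary.Definitions using (tri<; tri≈; tri>)
open import Relation.Binary.PropositionalEquality
  using (_≡_; refl; sym; trans; cong; cong₂; subst; setoid; module ≡-Reasoning)

open Equivalence using (from)

T : List (List ℕ)
T = T₁₂₃,₁₃₂

above : ℕ → List ℕ → List ℕ
above x = filter (x <?_)

Pushable : ℕ → List ℕ → Set
Pushable x st = length (above x st) ≤ 1

pushable? : ∀ x st → Dec (Pushable x st)
pushable? x st = length (above x st) ≤? 1

length-above-⊆ : ∀ {x sub st} → All (x <_) sub → sub ⊆ st → length sub ≤ length (above x st)
length-above-⊆ {x} sub>x sub⊆st =
  subst (_≤ _) (cong length (filter-all (x <?_) sub>x))
        (Sublist.length-mono-≤ (Sublist.filter⁺ (x <?_) (x <?_) (λ { refl p → p }) sub⊆st))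

Avoids-⊆ : ∀ {xs ys τ} → xs ⊆ ys → Avoids ys τ → Avoids xs τ
Avoids-⊆ xs⊆ys avoids (sub , sub⊆xs , iso) = avoids (sub , ⊆-trans sub⊆xs xs⊆ys , iso)

avoids-[] : AvoidsAll T []
avoids-[] = noPattern ∷ noPattern ∷ []
  where
  noPattern : ∀ {τ} → ¬ Contains [] (1 ∷ τ)
  noPattern (_ , [] , ())

-- Both 123 and 132 have the shape 1bc with b, c > 1.
push-avoids : ∀ {x st} → AvoidsAll T st → Pushable x st → AvoidsAll T (x ∷ st)
push-avoids {x} {st} (avoids₁₂₃ ∷ avoids₁₃₂ ∷ []) pushable =
  extend (s<s z<s) (s<s z<s) avoids₁₂₃ ∷ extend (s<s z<s) (s<s z<s) avoids₁₃₂ ∷ []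
  where
  extend : ∀ {b c} → 1 < b → 1 < c → Avoids st (1 ∷ b ∷ c ∷ []) → Avoids (x ∷ st) (1 ∷ b ∷ c ∷ [])
  extend _ _ avoids (sub , _ ∷ʳ sub⊆st , iso) = avoids (sub , sub⊆st , iso)
  extend 1<b 1<c _ (_ , refl ∷ uv⊆st , ((x~u , _) ∷ (x~v , _) ∷ []) ∷ _) =
    <-irrefl refl (≤-trans (length-above-⊆ (from x~u 1<b ∷ from x~v 1<c ∷ []) uv⊆st) pushable)

both : ∀ {P Q : Set} → P → Q → P ⇔ Q
both p q = mk⇔ (λ _ → q) (λ _ → p)

neither : ∀ {P Q : Set} → ¬ P → ¬ Q → P ⇔ Q
neither ¬p ¬q = mk⇔ (λ p → contradiction p ¬p) (λ q → contradiction q ¬q)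

agree-< : ∀ {x u a b} → x < u → a < b → ((x < u) ⇔ (a < b)) × ((u < x) ⇔ (b < a))
agree-< x<u a<b = both x<u a<b , neither (<⇒≯ x<u) (<⇒≯ a<b)

agree-> : ∀ {x u a b} → u < x → b < a → ((x < u) ⇔ (a < b)) × ((u < x) ⇔ (b < a))
agree-> u<x b<a = neither (<⇒≯ u<x) (<⇒≯ b<a) , both u<x b<a

push-blocked : ∀ {x st} → Unique st → ¬ Pushable x st → ¬ AvoidsAll T (x ∷ st)
push-blocked {x} {st} distinct ¬pushable (avoids₁₂₃ ∷ avoids₁₃₂ ∷ [])
  with above x st | Sublist.filter-⊆ (x <?_) st | All.all-filter (x <?_) st | Unique.filter⁺ (x <?_) distinct
... | [] | _ | _ | _ = ¬pushable z≤n
... | _ ∷ [] | _ | _ | _ = ¬pushable (s≤s z≤n)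
... | u ∷ v ∷ _ | uv⋯⊆st | x<u ∷ x<v ∷ _ | (u≢v ∷ _) ∷ _ with <-cmp u v
...   | tri< u<v _ _ = avoids₁₂₃ (x ∷ u ∷ v ∷ [] , refl ∷ uv⊆st ,
        (agree-< x<u (s<s z<s) ∷ agree-< x<v (s<s z<s) ∷ []) ∷ (agree-< u<v (s<s (s<s z<s)) ∷ []) ∷ [] ∷ [])
  where uv⊆st = ⊆-trans (refl ∷ refl ∷ minimum _) uv⋯⊆st
...   | tri≈ _ u≡v _ = u≢v u≡v
...   | tri> _ _ v<u = avoids₁₃₂ (x ∷ u ∷ v ∷ [] , refl ∷ uv⊆st ,
        (agree-< x<u (s<s z<s) ∷ agree-< x<v (s<s z<s) ∷ []) ∷ (agree-> v<u (s<s (s<s z<s)) ∷ []) ∷ [] ∷ [])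
  where uv⊆st = ⊆-trans (refl ∷ refl ∷ minimum _) uv⋯⊆st

Unique-resp-↭ : ∀ {xs ys : List ℕ} → xs ↭ ys → Unique xs → Unique ys
Unique-resp-↭ = PermutationSetoid.Unique-resp-↭ (setoid ℕ) ∘ ↭⇒↭ₛ

Unique-++⁻ʳ : ∀ (xs : List ℕ) {ys} → Unique (xs ++ ys) → Unique ys
Unique-++⁻ʳ []       distinct       = distinct
Unique-++⁻ʳ (_ ∷ xs) (_ ∷ distinct) = Unique-++⁻ʳ xs distinct

pops : ℕ → List ℕ → List ℕ × List ℕ
pops x [] = [] , []
pops x (y ∷ st) with pushable? x (y ∷ st)
... | yes _ = [] , y ∷ st
... | no _  = map₁ (y ∷_) (pops x st)

popped kept : ℕ → List ℕ → List ℕ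
popped x st = proj₁ (pops x st)
kept   x st = proj₂ (pops x st)

run : List ℕ → List ℕ → List ℕ
run []        st = st
run (x ∷ inp) st = popped x st ++ run inp (x ∷ kept x st)

stackSort : List ℕ → List ℕ
stackSort π = run π []

popped++kept : ∀ x st → popped x st ++ kept x st ≡ st
popped++kept x [] = refl
popped++kept x (y ∷ st) with pushable? x (y ∷ st)
... | yes _ = refl
... | no _  = cong (y ∷_) (popped++kept x st)

kept-pushable : ∀ x st → Pushable x (kept x st)
kept-pushable x [] = z≤n
kept-pushable x (y ∷ st) with pushable? x (y ∷ st)
... | yes pushable = pushable
... | no _         = kept-pushable x st

kept-⊆ : ∀ x st → kept x st ⊆ st
kept-⊆ x st = subst (kept x st ⊆_) (popped++kept x st) (Sublist.++⁺ˡ (popped x st) ⊆-refl)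

step-↭ : ∀ x inp st → x ∷ inp ++ st ↭ popped x st ++ inp ++ x ∷ kept x st
step-↭ x inp st = subst (λ s → x ∷ inp ++ s ↭ popped x st ++ inp ++ x ∷ kept x st) (popped++kept x st)
  (↭-trans (shifts (x ∷ inp) (popped x st)) (++⁺ˡ (popped x st) (↭-sym (shift x inp (kept x st)))))

Run-trans : ∀ {a b c} → Run T a b → Run T b c → Run T a c
Run-trans done      r = r
Run-trans (s ▸ r₁) r₂ = s ▸ Run-trans r₁ r₂

Run-output-≡ : ∀ {c i s o o′} → o ≡ o′ → Run T c ⟨ i , s , o ⟩ → Run T c ⟨ i , s , o′ ⟩
Run-output-≡ refl r = r

flush : ∀ st out → Run T ⟨ [] , st , out ⟩ ⟨ [] , [] , out ++ st ⟩
flush []       out = Run-output-≡ (sym (++-identityʳ out)) done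
flush (y ∷ st) out = pop (λ ()) ▸ Run-output-≡ (++-assoc out [ y ] st) (flush st (out ++ [ y ]))

pop-until-pushable : ∀ x inp st out → Unique st →
  Run T ⟨ x ∷ inp , st , out ⟩ ⟨ x ∷ inp , kept x st , out ++ popped x st ⟩
pop-until-pushable x inp [] out _ = Run-output-≡ (sym (++-identityʳ out)) done
pop-until-pushable x inp (y ∷ st) out distinct with pushable? x (y ∷ st)
... | yes _ = Run-output-≡ (sym (++-identityʳ out)) done
... | no ¬pushable = pop (push-blocked distinct ¬pushable) ▸
      Run-output-≡ (++-assoc out [ y ] _) (pop-until-pushable x inp st (out ++ [ y ]) (Unique-++⁻ʳ [ y ] distinct))

run-correct : ∀ inp st out → Unique (inp ++ st) → AvoidsAll T st →
              Run T ⟨ inp , st , out ⟩ ⟨ [] , [] , out ++ run inp st ⟩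
run-correct []        st out _        _      = flush st out
run-correct (x ∷ inp) st out distinct avoids =
  Run-trans (pop-until-pushable x inp st out (Unique-++⁻ʳ (x ∷ inp) distinct))
    (push avoids′ ▸ Run-output-≡ (++-assoc out (popped x st) _)
      (run-correct inp (x ∷ kept x st) (out ++ popped x st) distinct′ avoids′))
  where
  avoids′ : AvoidsAll T (x ∷ kept x st)
  avoids′ = push-avoids (All.map (Avoids-⊆ (kept-⊆ x st)) avoids) (kept-pushable x st)
  distinct′ : Unique (inp ++ x ∷ kept x st)
  distinct′ = Unique-++⁻ʳ (popped x st) (Unique-resp-↭ (step-↭ x inp st) distinct)

stackSort-correct : ∀ π → Unique π → STSorts T π (stackSort π)
stackSort-correct π distinct =
  run-correct π [] [] (subst Unique (sym (++-identityʳ π)) distinct) avoids-[]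

feed : List ℕ → List ℕ → List ℕ × List ℕ
feed []        st = [] , st
feed (x ∷ inp) st = map₁ (popped x st ++_) (feed inp (x ∷ kept x st))

feed-stack : List ℕ → List ℕ → List ℕ
feed-stack inp st = proj₂ (feed inp st)

run-++ : ∀ A B st → run (A ++ B) st ≡ proj₁ (feed A st) ++ run B (feed-stack A st)
run-++ []      B st = refl
run-++ (x ∷ A) B st =
  trans (cong (popped x st ++_) (run-++ A B (x ∷ kept x st))) (sym (++-assoc (popped x st) _ _))

feed-stack-++ : ∀ A B st → feed-stack (A ++ B) st ≡ feed-stack B (feed-stack A st)
feed-stack-++ []      B st = refl
feed-stack-++ (x ∷ A) B st = feed-stack-++ A B (x ∷ kept x st)

run-↭ : ∀ inp st → run inp st ↭ inp ++ st
run-↭ []        st = ↭-refl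
run-↭ (x ∷ inp) st = ↭-trans (++⁺ˡ (popped x st) (run-↭ inp (x ∷ kept x st))) (↭-sym (step-↭ x inp st))

feed-↭ : ∀ inp st → proj₁ (feed inp st) ++ feed-stack inp st ↭ inp ++ st
feed-↭ []        st = ↭-refl
feed-↭ (x ∷ inp) st = ↭-trans (↭-reflexive (++-assoc (popped x st) _ _))
  (↭-trans (++⁺ˡ (popped x st) (feed-↭ inp (x ∷ kept x st))) (↭-sym (step-↭ x inp st)))

feed-stack-All : ∀ {P : ℕ → Set} A → All P A → All P (feed-stack A [])
feed-stack-All A pA = All.++⁻ʳ (proj₁ (feed A [])) (All-resp-↭ (↭-sym (feed-↭ A [])) (All.++⁺ pA []))

pushable-[_] : ∀ c x → Pushable x [ c ]
pushable-[ c ] x = length-filter (x <?_) [ c ]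

pushable-over : ∀ {x m} c → m < x → Pushable x (m ∷ [ c ])
pushable-over {x} c m<x =
  subst (_≤ 1) (sym (cong length (filter-reject (x <?_) (<⇒≯ m<x)))) (pushable-[ c ] x)

pops-pushable : ∀ {x st} → Pushable x st → pops x st ≡ ([] , st)
pops-pushable {x} {[]}     _        = refl
pops-pushable {x} {y ∷ st} pushable with pushable? x (y ∷ st)
... | yes _         = refl
... | no ¬pushable = contradiction pushable ¬pushable

pops-all-but-bottom : ∀ x xs c → All (x <_) (xs ++ [ c ]) → pops x (xs ++ [ c ]) ≡ (xs , [ c ])
pops-all-but-bottom x [] c _ = pops-pushable (pushable-[ c ] x)
pops-all-but-bottom x (y ∷ xs) c (x<y ∷ x<xs) with pushable? x (y ∷ xs ++ [ c ])
... | yes pushable = contradiction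
        (≤-trans (length-above-⊆ (x<y ∷ All.++⁻ʳ xs x<xs) (refl ∷ Sublist.++⁺ˡ xs ⊆-refl)) pushable)
        λ { (s≤s ()) }
... | no _ rewrite pops-all-but-bottom x xs c x<xs = refl

kept-over-bottom : ∀ {x S} → Pushable x S → ∀ ys → ∃ λ ys′ → kept x (ys ++ S) ≡ ys′ ++ S
kept-over-bottom {x} {S} pushable [] = [] , cong proj₂ (pops-pushable pushable)
kept-over-bottom {x} {S} pushable (y ∷ ys) with pushable? x (y ∷ ys ++ S)
... | yes _ = y ∷ ys , refl
... | no _  = kept-over-bottom pushable ys

feed-over-bottom : ∀ {S} inp → All (λ x → Pushable x S) inp → ∀ ys →
                   ∃ λ ys′ → feed-stack inp (ys ++ S) ≡ ys′ ++ S
feed-over-bottom      []        _                 ys = ys , refl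
feed-over-bottom {S} (x ∷ inp) (pushable ∷ rest) ys with kept-over-bottom {x} {S} pushable ys
... | ys₁ , eq rewrite eq = feed-over-bottom inp rest (x ∷ ys₁)

feed-bottom : ∀ c A₀ → ∃ λ ys → feed-stack (c ∷ A₀) [] ≡ ys ++ [ c ]
feed-bottom c A₀ = feed-over-bottom A₀ (All.universal (pushable-[ c ]) A₀) []

zigzag : List ℕ → List ℕ
zigzag []       = []
zigzag (a ∷ as) = suc (length as) ∷ a ∷ zigzag as

zagzig : List ℕ → List ℕ
zagzig []       = []
zagzig (a ∷ as) = a ∷ suc (length as) ∷ zagzig as

zigzag-length : ∀ as → length (zigzag as) ≡ length as + length as
zigzag-length []       = refl
zigzag-length (a ∷ as) = cong suc (trans (cong suc (zigzag-length as)) (sym (+-suc (length as) (length as))))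

zigzag-∷ʳ : ∀ as c → zigzag (as ++ [ c ]) ≡ suc (length as) ∷ zagzig as ++ [ c ]
zigzag-∷ʳ []       c = refl
zigzag-∷ʳ (a ∷ as) c = cong₂ (λ k rest → suc k ∷ a ∷ rest) (length-++-comm as [ c ]) (zigzag-∷ʳ as c)

zagzig-∷ : ∀ B a as c → B ++ zagzig (a ∷ as) ++ [ c ] ≡ (B ++ [ a ]) ++ zigzag (as ++ [ c ])
zagzig-∷ B a as c = trans (cong (λ rest → B ++ a ∷ rest) (sym (zigzag-∷ʳ as c))) (sym (++-assoc B [ a ] _))

-- Each value k of zigzag pops all but the bottom entry c; the next entry of as
-- then rests on top of k.
run-zigzag : ∀ as xs c → All (length as <_) (xs ++ [ c ]) → All (length as <_) as →
             run (zigzag as) (xs ++ [ c ]) ≡ xs ++ zagzig as ++ [ c ]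
run-zigzag []       xs c _ _ = refl
run-zigzag (a ∷ as) xs c xs>k (k<a ∷ as>k) = begin
  run (k ∷ a ∷ zigzag as) (xs ++ [ c ])
    ≡⟨ cong (λ p → proj₁ p ++ run (a ∷ zigzag as) (k ∷ proj₂ p)) (pops-all-but-bottom k xs c xs>k) ⟩
  xs ++ run (a ∷ zigzag as) (k ∷ [ c ])
    ≡⟨ cong (λ p → xs ++ proj₁ p ++ run (zigzag as) (a ∷ proj₂ p))
            (pops-pushable {a} {k ∷ [ c ]} (pushable-over c k<a)) ⟩
  xs ++ run (zigzag as) ((a ∷ k ∷ []) ++ [ c ])
    ≡⟨ cong (xs ++_) (run-zigzag as (a ∷ k ∷ []) c (<-trans (n<1+n _) k<a ∷ n<1+n _ ∷ c>k′ ∷ [])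
                                                      (All.map (<-trans (n<1+n _)) as>k)) ⟩
  xs ++ zagzig (a ∷ as) ++ [ c ] ∎
  where
  open ≡-Reasoning
  k = suc (length as)
  c>k′ : length as < c
  c>k′ = <-trans (n<1+n _) (All.lookup xs>k (∈-++⁺ʳ xs (here refl)))

stackSort-zigzag : ∀ A as {ys c} → feed-stack A [] ≡ ys ++ [ c ] →
                   All (length as <_) A → All (length as <_) as →
                   stackSort (A ++ zigzag as) ≡ (proj₁ (feed A []) ++ ys) ++ zagzig as ++ [ c ]
stackSort-zigzag A as {ys} {c} stack≡ A>k as>k = begin
  run (A ++ zigzag as) []               ≡⟨ run-++ A (zigzag as) [] ⟩
  o ++ run (zigzag as) (feed-stack A []) ≡⟨ cong (λ st → o ++ run (zigzag as) st) stack≡ ⟩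
  o ++ run (zigzag as) (ys ++ [ c ])     ≡⟨ cong (o ++_) (run-zigzag as ys c stack>k as>k) ⟩
  o ++ ys ++ zagzig as ++ [ c ]          ≡⟨ sym (++-assoc o ys _) ⟩
  (o ++ ys) ++ zagzig as ++ [ c ]        ∎
  where
  open ≡-Reasoning
  o = proj₁ (feed A [])
  stack>k : All (length as <_) (ys ++ [ c ])
  stack>k = subst (All _) stack≡ (feed-stack-All A A>k)

pass-prefix : ∀ c A₀ as → All (length as <_) (c ∷ A₀) → All (length as <_) as →
              ∃ λ B → stackSort ((c ∷ A₀) ++ zigzag as) ≡ B ++ zagzig as ++ [ c ]
pass-prefix c A₀ as A>k as>k with feed-bottom c A₀
... | ys , stack≡ = proj₁ (feed (c ∷ A₀) []) ++ ys , stackSort-zigzag (c ∷ A₀) as stack≡ A>k as>k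

-- m clears the stack down to a₀, and the later, larger entries never pop it.
feed-stack-through : ∀ m a₀ A₁ A₂ → All (m <_) (a₀ ∷ A₁) → All (m <_) A₂ →
                     ∃ λ ys → feed-stack (a₀ ∷ A₁ ++ m ∷ A₂) [] ≡ ys ++ m ∷ [ a₀ ]
feed-stack-through m a₀ A₁ A₂ A₁>m A₂>m
  with feed-bottom a₀ A₁ | feed-over-bottom A₂ (All.map (pushable-over a₀) A₂>m) []
... | ys₁ , stack₁≡ | ys₂ , stack₂≡ = ys₂ , (begin
  feed-stack ((a₀ ∷ A₁) ++ m ∷ A₂) []              ≡⟨ feed-stack-++ (a₀ ∷ A₁) (m ∷ A₂) [] ⟩
  feed-stack (m ∷ A₂) (feed-stack (a₀ ∷ A₁) [])    ≡⟨ cong (feed-stack (m ∷ A₂)) stack₁≡ ⟩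
  feed-stack A₂ (m ∷ kept m (ys₁ ++ [ a₀ ]))       ≡⟨ cong (λ p → feed-stack A₂ (m ∷ proj₂ p))
                                                         (pops-all-but-bottom m ys₁ a₀ stack₁>m) ⟩
  feed-stack A₂ (m ∷ [ a₀ ])                        ≡⟨ stack₂≡ ⟩
  ys₂ ++ m ∷ [ a₀ ]                                 ∎)
  where
  open ≡-Reasoning
  stack₁>m : All (m <_) (ys₁ ++ [ a₀ ])
  stack₁>m = subst (All _) stack₁≡ (feed-stack-All (a₀ ∷ A₁) A₁>m)

pass-through : ∀ a₀ A₁ A₂ as → All (suc (length as) <_) (a₀ ∷ A₁) → All (suc (length as) <_) A₂ →
               All (length as <_) as →
               ∃ λ B → stackSort ((a₀ ∷ A₁ ++ suc (length as) ∷ A₂) ++ zigzag as)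
                       ≡ B ++ zigzag (as ++ [ a₀ ])
pass-through a₀ A₁ A₂ as A₁>m A₂>m as>k with feed-stack-through m a₀ A₁ A₂ A₁>m A₂>m
  where m = suc (length as)
... | ys , stack≡ = o ++ ys , (begin
  stackSort (A ++ zigzag as)                     ≡⟨ stackSort-zigzag A as stack≡′ A>k as>k ⟩
  (o ++ ys ++ [ m ]) ++ zagzig as ++ [ a₀ ]       ≡⟨ cong (_++ zagzig as ++ [ a₀ ]) (sym (++-assoc o ys [ m ])) ⟩
  ((o ++ ys) ++ [ m ]) ++ zagzig as ++ [ a₀ ]     ≡⟨ ++-assoc (o ++ ys) [ m ] _ ⟩
  (o ++ ys) ++ m ∷ zagzig as ++ [ a₀ ]            ≡⟨ cong ((o ++ ys) ++_) (sym (zigzag-∷ʳ as a₀)) ⟩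
  (o ++ ys) ++ zigzag (as ++ [ a₀ ])              ∎)
  where
  open ≡-Reasoning
  m = suc (length as)
  A = a₀ ∷ A₁ ++ m ∷ A₂
  o = proj₁ (feed A [])
  stack≡′ : feed-stack A [] ≡ (ys ++ [ m ]) ++ [ a₀ ]
  stack≡′ = trans stack≡ (sym (++-assoc ys [ m ] [ a₀ ]))
  A>k : All (length as <_) A
  A>k = All.++⁺ (All.map (<-trans (n<1+n _)) A₁>m) (n<1+n _ ∷ All.map (<-trans (n<1+n _)) A₂>m)

Unique-++-disjoint : ∀ (xs : List ℕ) {ys x} → Unique (xs ++ ys) → x ∈ xs → x ∈ ys → ⊥
Unique-++-disjoint (_ ∷ xs) (x∉ ∷ _)        (here refl) x∈ys = All.lookup x∉ (∈-++⁺ʳ xs x∈ys) refl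
Unique-++-disjoint (_ ∷ xs) (_ ∷ distinct) (there x∈xs) x∈ys = Unique-++-disjoint xs distinct x∈xs x∈ys

zigzag-↭ : ∀ as → zigzag as ↭ applyDownFrom suc (length as) ++ as
zigzag-↭ []       = ↭-refl
zigzag-↭ (a ∷ as) =
  prep _ (↭-trans (prep a (zigzag-↭ as)) (↭-sym (shift a (applyDownFrom suc (length as)) as)))

IsPerm-Unique : ∀ {n σ} → IsPerm n σ → Unique σ
IsPerm-Unique {n} σ↭ = Unique-resp-↭ (↭-sym σ↭) (Unique.map⁺ suc-injective (Unique.upTo⁺ n))

record ZigzagShape (n : ℕ) (A as : List ℕ) : Set where
  field
    distinct : Unique (A ++ as)
    large    : All (length as <_) (A ++ as)
    size     : length A + (length as + length as) ≡ n
    next-∈   : 1 ≤ length A → suc (length as) ∈ A ++ as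

-- zigzag as consists of as and 1, …, k, so A ++ as holds exactly k+1, …, n.
zigzag-shape : ∀ {n} A as → IsPerm n (A ++ zigzag as) → ZigzagShape n A as
zigzag-shape {n} A as σ↭ = record
  { distinct = Unique-++⁻ʳ small distinct-all
  ; large    = All.tabulate large
  ; size     = size
  ; next-∈   = next-∈
  }
  where
  k = length as
  small = applyDownFrom suc k
  split : A ++ zigzag as ↭ small ++ A ++ as
  split = ↭-trans (++⁺ˡ A (zigzag-↭ as)) (shifts A small)
  distinct-all : Unique (small ++ A ++ as)
  distinct-all = Unique-resp-↭ split (IsPerm-Unique σ↭)
  large : ∀ {x} → x ∈ A ++ as → k < x
  large x∈ with ∈-map⁻ suc (∈-resp-↭ σ↭ (∈-resp-↭ (↭-sym split) (∈-++⁺ʳ small x∈)))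
  ... | _ , _ , refl = ≰⇒> λ x≤k → Unique-++-disjoint small distinct-all (∈-applyDownFrom⁺ suc x≤k) x∈
  size : length A + (k + k) ≡ n
  size = begin
    length A + (k + k)              ≡⟨ cong (length A +_) (sym (zigzag-length as)) ⟩
    length A + length (zigzag as)   ≡⟨ sym (length-++ A) ⟩
    length (A ++ zigzag as)         ≡⟨ ↭-length σ↭ ⟩
    length (map suc (upTo n))       ≡⟨ length-map suc (upTo n) ⟩
    length (upTo n)                 ≡⟨ length-upTo n ⟩
    n                               ∎
    where open ≡-Reasoning
  next-∈ : 1 ≤ length A → suc k ∈ A ++ as
  next-∈ 1≤A with ∈-++⁻ small (∈-resp-↭ split (∈-resp-↭ (↭-sym σ↭) (∈-map⁺ suc (∈-upTo⁺ k<n))))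
    where
    k<n : k < n
    k<n = subst (k <_) size (≤-trans (s≤s (m≤n+m k k)) (+-monoˡ-≤ (k + k) 1≤A))
  ... | inj₁ k+1∈small with ∈-applyDownFrom⁻ suc k+1∈small
  ...   | _ , i<k , refl = contradiction i<k (<-irrefl refl)
  next-∈ _ | inj₂ k+1∈ = k+1∈

!-++ : ∀ (A L : List ℕ) i → (A ++ L) ! (length A + i) ≡ L ! i
!-++ []      L i = refl
!-++ (_ ∷ A) L i = !-++ A L i

zigzag-! : ∀ as i → i < length as → zigzag as ! (2 * i) ≡ just (length as ∸ i)
zigzag-! (a ∷ as) zero    _         = refl
zigzag-! (a ∷ as) (suc i) (s≤s i<k) rewrite +-suc i (i + 0) = zigzag-! as i i<k

≤-half : ∀ {a j k} → a ≤ 2 → 2 * j + 1 ≤ a + 2 * k → j ≤ k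
≤-half {a} {j} {k} a≤2 bound = s≤s⁻¹ (*-cancelˡ-< 2 j (suc k) (begin-strict
  2 * j     <⟨ m<m+n (2 * j) z<s ⟩
  2 * j + 1 ≤⟨ bound ⟩
  a + 2 * k ≤⟨ +-monoˡ-≤ (2 * k) a≤2 ⟩
  2 + 2 * k ≡⟨ sym (*-suc 2 k) ⟩
  2 * suc k ∎))
  where open ≤-Reasoning

halfDecreasing-short-prefix : ∀ A as → length A ≤ 2 → HalfDecreasing (A ++ zigzag as)
halfDecreasing-short-prefix A as A≤2 j 1≤j bound = begin
  σ ! (length σ ∸ 2 * j)               ≡⟨ cong (σ !_) index≡ ⟩
  σ ! (length A + 2 * (k ∸ j))         ≡⟨ !-++ A (zigzag as) (2 * (k ∸ j)) ⟩
  zigzag as ! (2 * (k ∸ j))            ≡⟨ zigzag-! as (k ∸ j) (∸-monoʳ-< 1≤j j≤k) ⟩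
  just (k ∸ (k ∸ j))                   ≡⟨ cong just (m∸[m∸n]≡n j≤k) ⟩
  just j                               ∎
  where
  open ≡-Reasoning
  σ = A ++ zigzag as
  k = length as
  length-σ : length σ ≡ length A + 2 * k
  length-σ = trans (length-++ A) (cong (length A +_) (trans (zigzag-length as) (cong (k +_) (sym (+-identityʳ k)))))
  j≤k : j ≤ k
  j≤k = ≤-half A≤2 (subst (2 * j + 1 ≤_) length-σ bound)
  index≡ : length σ ∸ 2 * j ≡ length A + 2 * (k ∸ j)
  index≡ = begin
    length σ ∸ 2 * j               ≡⟨ cong (_∸ 2 * j) length-σ ⟩
    length A + 2 * k ∸ 2 * j       ≡⟨ +-∸-assoc (length A) (*-monoʳ-≤ 2 j≤k) ⟩
    length A + (2 * k ∸ 2 * j)     ≡⟨ cong (length A +_) (sym (*-distribˡ-∸ 2 k j)) ⟩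
    length A + 2 * (k ∸ j)         ∎

stackSort-IsPerm : ∀ {n σ} → IsPerm n σ → IsPerm n (stackSort σ)
stackSort-IsPerm {σ = σ} σ↭ = ↭-trans (run-↭ σ []) (↭-trans (↭-reflexive (++-identityʳ σ)) σ↭)

above-next : ∀ {k} P Q → Unique (P ++ suc k ∷ Q) → All (k <_) (P ++ suc k ∷ Q) → All (suc k <_) (P ++ Q)
above-next P Q distinct large with Unique-resp-↭ (shift _ P Q) distinct | All-resp-↭ (shift _ P Q) large
... | k+1∉ ∷ _ | _ ∷ rest = All.zipWith (λ (k+1≢x , k<x) → ≤∧≢⇒< k<x k+1≢x) (k+1∉ , rest)

+-double-suc : ∀ d k → d + (suc k + suc k) ≡ suc (suc d) + (k + k)
+-double-suc d k = begin
  d + (suc k + suc k)     ≡⟨ cong (λ l → d + suc l) (+-suc k k) ⟩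
  d + suc (suc (k + k))   ≡⟨ +-suc d (suc (k + k)) ⟩
  suc (d + suc (k + k))   ≡⟨ cong suc (+-suc d (k + k)) ⟩
  suc (suc d) + (k + k)   ∎
  where open ≡-Reasoning

EventuallyHalfDecreasing : List ℕ → Set
EventuallyHalfDecreasing σ = ∃ λ m → ∃ λ ρ → Iterate T m σ ρ × HalfDecreasing ρ

module Descent (n : ℕ) where

  after-pass : ∀ {σ σ′} → IsPerm n σ → stackSort σ ≡ σ′ →
               (IsPerm n σ′ → EventuallyHalfDecreasing σ′) → EventuallyHalfDecreasing σ
  after-pass {σ} σ↭ refl continue with continue (stackSort-IsPerm σ↭)
  ... | m , ρ , iterate , halfDecreasing =
    suc m , ρ , suc (stackSort-correct σ (IsPerm-Unique σ↭)) iterate , halfDecreasing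

  prefix-length : ∀ d A as → d + (length as + length as) ≡ n → IsPerm n (A ++ zigzag as) → length A ≡ d
  prefix-length d A as budget σ↭ =
    +-cancelʳ-≡ _ (length A) _ (trans (ZigzagShape.size (zigzag-shape A as σ↭)) (sym budget))

  Descends : ℕ → Set
  Descends d = ∀ A as → d + (length as + length as) ≡ n → IsPerm n (A ++ zigzag as) →
               EventuallyHalfDecreasing (A ++ zigzag as)

  short : ∀ {d} → d ≤ 2 → Descends d
  short {d} d≤2 A as budget σ↭ =
    0 , _ , zero , halfDecreasing-short-prefix A as (subst (_≤ 2) (sym (prefix-length d A as budget σ↭)) d≤2)

  module _ (d : ℕ) (descend : Descends d) where

    Budget : ℕ → Set
    Budget k = suc (suc d) + (k + k) ≡ n

    next-through : ∀ m a₀ A₁ A₂ as → m ≡ suc (length as) → Budget (length as) →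
                   IsPerm n ((a₀ ∷ A₁ ++ m ∷ A₂) ++ zigzag as) →
                   EventuallyHalfDecreasing ((a₀ ∷ A₁ ++ m ∷ A₂) ++ zigzag as)
    next-through m a₀ A₁ A₂ as refl budget σ↭
      with pass-through a₀ A₁ A₂ as (All.++⁻ˡ (a₀ ∷ A₁) others>m) (All.++⁻ʳ (a₀ ∷ A₁) others>m) as>k
      where
      open ZigzagShape (zigzag-shape _ as σ↭)
      reassoc : (a₀ ∷ A₁ ++ m ∷ A₂) ++ as ≡ (a₀ ∷ A₁) ++ m ∷ (A₂ ++ as)
      reassoc = cong (a₀ ∷_) (++-assoc A₁ (m ∷ A₂) as)
      others>m = All.++⁻ˡ (a₀ ∷ A₁ ++ A₂) (subst (All (m <_)) (cong (a₀ ∷_) (sym (++-assoc A₁ A₂ as)))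
        (above-next (a₀ ∷ A₁) (A₂ ++ as) (subst Unique reassoc distinct) (subst (All _) reassoc large)))
      as>k = All.++⁻ʳ (a₀ ∷ A₁ ++ m ∷ A₂) large
    ... | B , sorted = after-pass σ↭ sorted (descend B (as ++ [ a₀ ]) budget′)
      where
      budget′ : d + (length (as ++ [ a₀ ]) + length (as ++ [ a₀ ])) ≡ n
      budget′ = trans (cong (λ l → d + (l + l)) (length-++-comm as [ a₀ ]))
                      (trans (+-double-suc d (length as)) budget)

    next-last : ∀ B m as → m ≡ suc (length as) → Budget (length as) →
                IsPerm n ((B ++ [ m ]) ++ zigzag as) → EventuallyHalfDecreasing ((B ++ [ m ]) ++ zigzag as)
    next-last []      m as _  budget σ↭ with () ← prefix-length (suc (suc d)) [ m ] as budget σ↭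
    next-last (b ∷ B) m as m≡ budget σ↭ = next-through m b B [] as m≡ budget σ↭

    next-in-tail : ∀ A bs m cs → m ≡ suc (length (bs ++ m ∷ cs)) → Budget (length (bs ++ m ∷ cs)) →
                   IsPerm n (A ++ zigzag (bs ++ m ∷ cs)) → EventuallyHalfDecreasing (A ++ zigzag (bs ++ m ∷ cs))
    next-in-tail [] bs m cs _ budget σ↭ with () ← prefix-length (suc (suc d)) [] _ budget σ↭
    next-in-tail (c ∷ A₀) [] m cs m≡ budget σ↭
      with pass-prefix c A₀ (m ∷ cs) (All.++⁻ˡ (c ∷ A₀) large) (All.++⁻ʳ (c ∷ A₀) large)
      where open ZigzagShape (zigzag-shape (c ∷ A₀) (m ∷ cs) σ↭)
    ... | B , sorted = after-pass σ↭ (trans sorted (zagzig-∷ B m cs c))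
      (next-last B m (cs ++ [ c ]) (trans m≡ (cong suc (sym cs∷ʳc-length)))
                                   (subst Budget (sym cs∷ʳc-length) budget))
      where
      cs∷ʳc-length : length (cs ++ [ c ]) ≡ length (m ∷ cs)
      cs∷ʳc-length = length-++-comm cs [ c ]
    next-in-tail (c ∷ A₀) (b ∷ bs) m cs m≡ budget σ↭
      with pass-prefix c A₀ (b ∷ bs ++ m ∷ cs) (All.++⁻ˡ (c ∷ A₀) large) (All.++⁻ʳ (c ∷ A₀) large)
      where open ZigzagShape (zigzag-shape (c ∷ A₀) (b ∷ bs ++ m ∷ cs) σ↭)
    ... | B , sorted = after-pass σ↭ sorted′
      (next-in-tail (B ++ [ b ]) bs m (cs ++ [ c ]) (trans m≡ (cong suc (sym tail-length)))
                                                   (subst Budget (sym tail-length) budget))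
      where
      tail-length : length (bs ++ m ∷ cs ++ [ c ]) ≡ length (b ∷ bs ++ m ∷ cs)
      tail-length = trans (cong length (sym (++-assoc bs (m ∷ cs) [ c ]))) (length-++-comm (bs ++ m ∷ cs) [ c ])
      sorted′ : stackSort ((c ∷ A₀) ++ zigzag (b ∷ bs ++ m ∷ cs))
                ≡ (B ++ [ b ]) ++ zigzag (bs ++ m ∷ cs ++ [ c ])
      sorted′ = trans sorted (trans (zagzig-∷ B b (bs ++ m ∷ cs) c)
                  (cong (λ t → (B ++ [ b ]) ++ zigzag t) (++-assoc bs (m ∷ cs) [ c ])))

    next-at-head : ∀ m A₂ as → m ≡ suc (length as) → Budget (length as) →
                   IsPerm n ((m ∷ A₂) ++ zigzag as) → EventuallyHalfDecreasing ((m ∷ A₂) ++ zigzag as)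
    next-at-head m A₂ [] m≡ budget σ↭
      with pass-prefix m A₂ [] (All.++⁻ˡ (m ∷ A₂) large) []
      where open ZigzagShape (zigzag-shape (m ∷ A₂) [] σ↭)
    ... | B , sorted = after-pass σ↭ (trans sorted (sym (++-identityʳ (B ++ [ m ])))) (next-last B m [] m≡ budget)
    next-at-head m A₂ (a ∷ as) m≡ budget σ↭
      with pass-prefix m A₂ (a ∷ as) (All.++⁻ˡ (m ∷ A₂) large) (All.++⁻ʳ (m ∷ A₂) large)
      where open ZigzagShape (zigzag-shape (m ∷ A₂) (a ∷ as) σ↭)
    ... | B , sorted = after-pass σ↭ (trans sorted (zagzig-∷ B a as m))
      (next-in-tail (B ++ [ a ]) as m [] (trans m≡ (cong suc (sym as∷ʳm-length)))
                                         (subst Budget (sym as∷ʳm-length) budget))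
      where
      as∷ʳm-length : length (as ++ [ m ]) ≡ length (a ∷ as)
      as∷ʳm-length = length-++-comm as [ m ]

    next-anywhere : ∀ A as m → m ≡ suc (length as) → Budget (length as) →
                    IsPerm n (A ++ zigzag as) → EventuallyHalfDecreasing (A ++ zigzag as)
    next-anywhere A as m m≡ budget σ↭
      with ∈-++⁻ A (subst (_∈ A ++ as) (sym m≡) (next-∈ 1≤A))
      where
      open ZigzagShape (zigzag-shape A as σ↭)
      1≤A : 1 ≤ length A
      1≤A = subst (1 ≤_) (sym (prefix-length (suc (suc d)) A as budget σ↭)) (s≤s z≤n)
    ... | inj₁ m∈A with ∈-∃++ m∈A
    ...   | []      , A₂ , refl = next-at-head m A₂ as m≡ budget σ↭
    ...   | a₀ ∷ A₁ , A₂ , refl = next-through m a₀ A₁ A₂ as m≡ budget σ↭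
    next-anywhere A as m m≡ budget σ↭ | inj₂ m∈as with ∈-∃++ m∈as
    ...   | bs , cs , refl = next-in-tail A bs m cs m≡ budget σ↭

  eventually : ∀ d → Descends d
  eventually 0                   = short z≤n
  eventually 1                   = short (s≤s z≤n)
  eventually 2                   = short ≤-refl
  eventually (suc (suc (suc d))) A as = next-anywhere (suc d) (eventually (suc d)) A as _ refl

lemma4p2 : (n : ℕ) (π : List ℕ) → IsPerm n π →
    ∃ λ (m : ℕ) → ∃ λ (σ : List ℕ) → Iterate T₁₂₃,₁₃₂ m π σ × HalfDecreasing σ
lemma4p2 n π π↭ = subst EventuallyHalfDecreasing (++-identityʳ π)
  (Descent.eventually n (length π) π [] (ZigzagShape.size (zigzag-shape π [] σ↭)) σ↭)
  where
  σ↭ : IsPerm n (π ++ zigzag [])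
  σ↭ = subst (IsPerm n) (sym (++-identityʳ π)) π↭
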